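{- Every Hamiltonian graph $G$ is direct-topfull.
   Context: Graphs are finite, simple and undirected; $d_G$ denotes shortest-path distance. For an integer $\ell\ge0$, an $\ell$-track on $G$ is a surjective function $f:\{0,\dots,\ell\}\to V(G)$ with $f(i)f(i+1)\in E(G)$ for all $0\le i<\ell$. For a family $F=\{f_1,\dots,f_p\}$ ($p\ge2$) of such functions, $m_G(F)=\min_{i\ne j}\min_t d_G(f_i(t),f_j(t))$. An $\ell$-tour is a family of $\ell$-tracks. $\mathrm{cap}^\times_1(G)$ is the maximum $c$ such that there is an $\ell$-tour $F=\{f_1,\dots,f_c\}$ on $G$ (some $\ell$) with $m_G(F)=1$. A connected graph on $n$ vertices is direct-topfull if $\mathrm{cap}^\times_1(G)=n$. -}

module Defs where

open import Data.Nat using (ℕ; zero; suc; _≤_; _<_)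
open import Data.Fin using (Fin; inject₁; fromℕ) renaming (zero to fzero; suc to fsuc)
open import Data.Empty using (⊥)
open import Data.Bool using (Bool; true; false)
open import Data.Product using (Σ; ∃; ∃-syntax; _×_; _,_)
open import Relation.Binary.PropositionalEquality using (_≡_; _≢_)
open import Function.Definitions using (Injective; Surjective)

record Graph (n : ℕ) : Set where
  field
    adj   : Fin n → Fin n → Bool
    sym   : ∀ u v → adj u v ≡ adj v u
    irrfl : ∀ u → adj u u ≡ false

open Graph public

Edge : ∀ {n} → Graph n → Fin n → Fin n → Set
Edge G u v = adj G u v ≡ true

data Walk {n : ℕ} (G : Graph n) : Fin n → Fin n → ℕ → Set where
  here : ∀ u → Walk G u u 0
  step : ∀ {u w v k} → Edge G u w → Walk G w v k → Walk G u v (suc k)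

Connected : ∀ {n} → Graph n → Set
Connected G = ∀ u v → ∃[ k ] Walk G u v k

Dist : ∀ {n} → Graph n → Fin n → Fin n → ℕ → Set
Dist G u v k = Walk G u v k × (∀ k′ → Walk G u v k′ → k ≤ k′)

-- Hamiltonian: there is a Hamiltonian cycle, i.e. a cyclic ordering
-- c 0, c 1, ..., c m of all (suc m) vertices (c bijective) with
-- consecutive vertices adjacent and c m adjacent to c 0; a cycle needs
-- at least 3 vertices.
Hamiltonian : ∀ {n} → Graph n → Set
Hamiltonian {zero} G = ⊥
Hamiltonian {suc m} G =
  2 ≤ m ×
  Σ (Fin (suc m) → Fin (suc m)) λ c →
    Injective _≡_ _≡_ c × Surjective _≡_ _≡_ c ×
    (∀ (i : Fin m) → Edge G (c (inject₁ i)) (c (fsuc i))) ×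
    Edge G (c (fromℕ m)) (c fzero)

IsTrack : ∀ {n} → Graph n → (ℓ : ℕ) → (Fin (suc ℓ) → Fin n) → Set
IsTrack G ℓ f =
  Surjective _≡_ _≡_ f × (∀ (i : Fin ℓ) → Edge G (f (inject₁ i)) (f (fsuc i)))

-- m_G(F) = 1 for a family F = (F 1, ..., F p) of ℓ-tracks, where
-- m_G(F) = min_{i ≠ j} min_t d_G(F i t, F j t):
-- every such distance is ≥ 1, and some such distance equals 1.
MinDistIsOne : ∀ {n p ℓ} → Graph n → (Fin p → Fin (suc ℓ) → Fin n) → Set
MinDistIsOne {p = p} {ℓ} G F =
  (∀ (i j : Fin p) → i ≢ j → ∀ t → ∃[ k ] (Dist G (F i t) (F j t) k × 1 ≤ k)) ×
  (∃[ i ] ∃[ j ] ∃[ t ] (i ≢ j × Dist G (F i t) (F j t) 1))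

HasTour₁ : ∀ {n} → Graph n → ℕ → Set
HasTour₁ G c =
  2 ≤ c × ∃[ ℓ ] Σ (Fin c → Fin (suc ℓ) → _) λ F →
    (∀ i → IsTrack G ℓ (F i)) × MinDistIsOne G F

Cap₁Is : ∀ {n} → Graph n → ℕ → Set
Cap₁Is G c = HasTour₁ G c × (∀ c′ → HasTour₁ G c′ → c′ ≤ c)

DirectTopfull : ∀ {n} → Graph n → Set
DirectTopfull {n} G = Connected G × Cap₁Is G n

-- Label the vertices along a Hamiltonian cycle and let track i start at the
-- i-th vertex and walk around the cycle. All n tracks move in lockstep, so
-- at every time they occupy n distinct vertices, and at time 0 tracks 0 and
-- 1 sit on adjacent vertices, giving m_G(F) = 1. Conversely, any tour with
-- m_G(F) ≥ 1 has pairwise distinct starting vertices, so at most n tracks.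
module Submission where

open import Data.Nat using (ℕ; zero; suc; _+_; _∸_; _≤_; _<_; z≤n; s≤s)
open import Data.Nat.Properties
  using (≮⇒≥; <⇒≱; <⇒≤; +-comm; m∸n≤m; m∸n+n≡m; +-mono-<-≤; ≤-trans; n≤1+n; n<1+n; <-irrefl; anyUpTo?)
open import Data.Nat.Induction using (<-rec)
open import Data.Fin using (Fin; zero; suc; inject₁; fromℕ; fromℕ<; toℕ; _≟_)
open import Data.Fin.Properties
  using (toℕ-injective; toℕ-inject₁; toℕ-fromℕ; toℕ-fromℕ<; toℕ<n; injective⇒≤; any?)
open import Data.Fin.Relation.Unary.Top using (view; view-fromℕ; ‵fromℕ; ‵inject₁)
open import Data.Empty using (⊥-elim)
open import Data.Bool using (true)
import Data.Bool as Bool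
open import Data.Product using (∃-syntax; _×_; _,_; proj₁; proj₂)
open import Function.Definitions using (Injective; Surjective)
import Function.Endo.Propositional as Endo
open import Relation.Nullary using (Dec; yes; no)
open import Relation.Nullary.Decidable using (map′; _×-dec_)
open import Relation.Unary using (Decidable)
open import Relation.Binary.PropositionalEquality
  using (_≡_; _≢_; refl; sym; trans; cong; cong-app; subst; subst₂; module ≡-Reasoning)
open import Defs hiding (sym)

Least : (ℕ → Set) → Set
Least P = ∃[ n ] P n × (∀ k → P k → n ≤ k)

least-witness : {P : ℕ → Set} → Decidable P → ∀ k → P k → Least P
least-witness {P} P? = <-rec (λ k → P k → Least P) go
  where
    go : ∀ k → (∀ {j} → j < k → P j → Least P) → P k → Least P
    go k rec pk with anyUpTo? P? k
    ... | yes (j , j<k , pj) = rec j<k pj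
    ... | no none = k , pk , λ k′ pk′ → ≮⇒≥ (λ k′<k → none (k′ , k′<k , pk′))

module _ {n : ℕ} (G : Graph n) where

  walk-length-0 : ∀ {u v} → Walk G u v 0 → u ≡ v
  walk-length-0 (here _) = refl

  walk? : ∀ u v k → Dec (Walk G u v k)
  walk? u v zero = map′ (λ { refl → here u }) walk-length-0 (u ≟ v)
  walk? u v (suc k) =
    map′ (λ (w , e , p) → step e p) (λ { (step e p) → _ , e , p })
         (any? λ w → (adj G u w Bool.≟ true) ×-dec walk? w v k)

  walk-length≥1 : ∀ {u v k} → u ≢ v → Walk G u v k → 1 ≤ k
  walk-length≥1 {k = zero}  u≢v p = ⊥-elim (u≢v (walk-length-0 p))
  walk-length≥1 {k = suc _} _ _ = s≤s z≤n

  edge⇒≢ : ∀ {u v} → Edge G u v → u ≢ v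
  edge⇒≢ {u} e refl with trans (sym (irrfl G u)) e
  ... | ()

  edge⇒dist-1 : ∀ {u v} → Edge G u v → Dist G u v 1
  edge⇒dist-1 e = step e (here _) , λ _ → walk-length≥1 (edge⇒≢ e)

  dist-exists : Connected G → ∀ u v → ∃[ k ] Dist G u v k
  dist-exists conn u v = least-witness (walk? u v) _ (proj₂ (conn u v))

  dist≥1⇒≢ : ∀ {u v k} → Dist G u v k → 1 ≤ k → u ≢ v
  dist≥1⇒≢ (_ , shortest) 1≤k refl = <⇒≱ 1≤k (shortest 0 (here _))

  tour-size≤order : ∀ c → HasTour₁ G c → c ≤ n
  tour-size≤order c (_ , _ , F , _ , separated , _) = injective⇒≤ starts-injective
    where
      starts-injective : Injective _≡_ _≡_ (λ i → F i zero)
      starts-injective {i} {j} same with i ≟ j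
      ... | yes i≡j = i≡j
      ... | no i≢j with separated i j i≢j zero
      ... | _ , d , 1≤k = ⊥-elim (dist≥1⇒≢ d 1≤k same)

module Rotation (m : ℕ) where

  open Endo (Fin (suc m)) using (_^_; ^-homo)

  rotate : Fin (suc m) → Fin (suc m)
  rotate i with view i
  ... | ‵fromℕ     = zero
  ... | ‵inject₁ j = suc j

  rotate-fromℕ : rotate (fromℕ m) ≡ zero
  rotate-fromℕ rewrite view-fromℕ m = refl

  rotate-injective : Injective _≡_ _≡_ rotate
  rotate-injective {i} {j} eq with view i | view j
  rotate-injective refl | ‵fromℕ     | ‵fromℕ     = refl
  rotate-injective ()   | ‵fromℕ     | ‵inject₁ _
  rotate-injective ()   | ‵inject₁ _ | ‵fromℕ
  rotate-injective refl | ‵inject₁ _ | ‵inject₁ _ = refl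

  toℕ-rotate : ∀ i → toℕ i < m → toℕ (rotate i) ≡ suc (toℕ i)
  toℕ-rotate i i<m with view i
  ... | ‵fromℕ     = ⊥-elim (<-irrefl (toℕ-fromℕ m) i<m)
  ... | ‵inject₁ j = cong suc (sym (toℕ-inject₁ j))

  rotate^-injective : ∀ k → Injective _≡_ _≡_ (rotate ^ k)
  rotate^-injective zero    eq = eq
  rotate^-injective (suc k) eq = rotate^-injective k (rotate-injective eq)

  rotate^-sucʳ : ∀ k i → (rotate ^ suc k) i ≡ (rotate ^ k) (rotate i)
  rotate^-sucʳ k = cong-app (trans (cong (rotate ^_) (+-comm 1 k)) (^-homo rotate k 1))

  toℕ-rotate^-zero : ∀ k → k < suc m → toℕ ((rotate ^ k) zero) ≡ k
  toℕ-rotate^-zero zero    _         = refl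
  toℕ-rotate^-zero (suc k) (s≤s k<m) =
    trans (toℕ-rotate _ (subst (_< m) (sym ih) k<m)) (cong suc ih)
    where ih = toℕ-rotate^-zero k (≤-trans k<m (n≤1+n m))

  rotate^toℕ : ∀ i → (rotate ^ toℕ i) zero ≡ i
  rotate^toℕ i = toℕ-injective (toℕ-rotate^-zero (toℕ i) (toℕ<n i))

  rotate^order : (rotate ^ suc m) zero ≡ zero
  rotate^order = trans (cong rotate last) rotate-fromℕ
    where
      last : (rotate ^ m) zero ≡ fromℕ m
      last = toℕ-injective (trans (toℕ-rotate^-zero m (n<1+n m)) (sym (toℕ-fromℕ m)))

  rotate-orbit : ∀ a b → ∃[ t ] t < suc m + suc m × (rotate ^ t) a ≡ b
  rotate-orbit a b = t , +-mono-<-≤ (toℕ<n b) (m∸n≤m (suc m) (toℕ a)) , reach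
    where
      t = toℕ b + (suc m ∸ toℕ a)
      open ≡-Reasoning
      reach : (rotate ^ t) a ≡ b
      reach = begin
        (rotate ^ t) a
          ≡⟨ cong (rotate ^ t) (sym (rotate^toℕ a)) ⟩
        (rotate ^ t) ((rotate ^ toℕ a) zero)
          ≡⟨ cong-app (^-homo rotate (toℕ b) (suc m ∸ toℕ a)) _ ⟩
        (rotate ^ toℕ b) ((rotate ^ (suc m ∸ toℕ a)) ((rotate ^ toℕ a) zero))
          ≡⟨ cong (rotate ^ toℕ b) (cong-app (sym (^-homo rotate (suc m ∸ toℕ a) (toℕ a))) zero) ⟩
        (rotate ^ toℕ b) ((rotate ^ (suc m ∸ toℕ a + toℕ a)) zero)
          ≡⟨ cong (λ k → (rotate ^ toℕ b) ((rotate ^ k) zero)) (m∸n+n≡m (<⇒≤ (toℕ<n a))) ⟩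
        (rotate ^ toℕ b) ((rotate ^ suc m) zero)
          ≡⟨ cong (rotate ^ toℕ b) rotate^order ⟩
        (rotate ^ toℕ b) zero
          ≡⟨ rotate^toℕ b ⟩
        b ∎

module HamiltonianCycle
  {m : ℕ} (G : Graph (suc m)) (c : Fin (suc m) → Fin (suc m))
  (c-injective : Injective _≡_ _≡_ c) (c-surjective : Surjective _≡_ _≡_ c)
  (path-edge : ∀ (i : Fin m) → Edge G (c (inject₁ i)) (c (suc i)))
  (closing-edge : Edge G (c (fromℕ m)) (c zero))
  where

  open Rotation m
  open Endo (Fin (suc m)) using (_^_)

  cycle-edge : ∀ i → Edge G (c i) (c (rotate i))
  cycle-edge i with view i
  ... | ‵fromℕ     = closing-edge
  ... | ‵inject₁ j = path-edge j

  walk-around : ∀ k i → Walk G (c i) (c ((rotate ^ k) i)) k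
  walk-around zero    i = here _
  walk-around (suc k) i =
    step (cycle-edge i)
         (subst (λ x → Walk G (c (rotate i)) (c x) k) (sym (rotate^-sucʳ k i)) (walk-around k (rotate i)))

  connected : Connected G
  connected u v with c-surjective u | c-surjective v
  ... | a , ca≡u | b , cb≡v with rotate-orbit a b
  ... | t , _ , reach =
    t , subst₂ (λ x y → Walk G x y t) (ca≡u refl) (trans (cong c reach) (cb≡v refl)) (walk-around t a)

  -- 2N time steps let every track pass every vertex, whatever its start.
  tracks : Fin (suc m) → Fin (suc m + suc m) → Fin (suc m)
  tracks i t = c ((rotate ^ toℕ t) i)

  tracks-are-tracks : ∀ i → IsTrack G (m + suc m) (tracks i)
  tracks-are-tracks i = surjective , edges
    where
      surjective : Surjective _≡_ _≡_ (tracks i)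
      surjective v with c-surjective v
      ... | b , cb≡v with rotate-orbit i b
      ... | t , t<2N , reach =
        fromℕ< t<2N , λ { refl → trans (cong (λ s → c ((rotate ^ s) i)) (toℕ-fromℕ< t<2N))
                                       (trans (cong c reach) (cb≡v refl)) }
      edges : ∀ t → Edge G (tracks i (inject₁ t)) (tracks i (suc t))
      edges t = subst (λ s → Edge G (c ((rotate ^ s) i)) (tracks i (suc t))) (sym (toℕ-inject₁ t))
                      (cycle-edge ((rotate ^ toℕ t) i))

  tracks-disjoint : ∀ {i j} t → i ≢ j → tracks i t ≢ tracks j t
  tracks-disjoint t i≢j same = i≢j (rotate^-injective (toℕ t) (c-injective same))

  tracks-min-dist-1 : MinDistIsOne G tracks
  tracks-min-dist-1 =
    separated , zero , rotate zero , zero , zero≢rotate-zero , edge⇒dist-1 G (cycle-edge zero)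
    where
      separated : ∀ i j → i ≢ j → ∀ t → ∃[ k ] (Dist G (tracks i t) (tracks j t) k × 1 ≤ k)
      separated i j i≢j t with dist-exists G connected (tracks i t) (tracks j t)
      ... | k , d = k , d , walk-length≥1 G (tracks-disjoint t i≢j) (proj₁ d)
      zero≢rotate-zero : zero ≢ rotate zero
      zero≢rotate-zero same = edge⇒≢ G (cycle-edge zero) (cong c same)

corollary3p22 : ∀ {n : ℕ} (G : Graph n) → Hamiltonian G → DirectTopfull G
corollary3p22 {zero}  G ()
corollary3p22 {suc m} G (2≤m , c , c-injective , c-surjective , path-edge , closing-edge) =
  connected , (≤-trans 2≤m (n≤1+n m) , m + suc m , tracks , tracks-are-tracks , tracks-min-dist-1)
            , tour-size≤order G
  where open HamiltonianCycle G c c-injective c-surjective path-edge closing-edge
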